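{- Let $\mathcal M$ be a matroid on ground set $E$. If $I((\mathcal L^*)^{opp})$ is the family of independent sets of a matroid $\mathcal N_1$ on $\mathcal C(\mathcal M)$, then $\mathcal M$ has an adjoint and $\mathcal N_1$ is a minimal adjoint of $\mathcal M$ in the weak order of matroids on $\mathcal C(\mathcal M)$. If $\mathcal S(\mathcal M)$ is the family of independent sets of a matroid $\mathcal N_2$ on $\mathcal C(\mathcal M)$, then $\mathcal M$ has an adjoint and $\mathcal N_2$ is the maximal adjoint of $\mathcal M$ in the weak order of matroids on $\mathcal C(\mathcal M)$.
   Context: Let $n=|E|$, $d=\mathrm{rank}(\mathcal M)$, $\mathcal C(\mathcal M)$ the set of circuits, $\mathcal M^*$ the dual matroid. $\mathcal L^*$ is the lattice of flats of $\mathcal M^*$, and $(\mathcal L^*)^{opp}$ its order dual, a finite bounded atomic graded lattice with rank function $(n-d)-r_{\mathcal M^*}$, whose atoms are the hyperplanes $E\setminus C$ of $\mathcal M^*$, $C\in\mathcal C(\mathcal M)$, identified with the circuits $C$. For a finite bounded lattice and a linear order $\omega$ on its atoms, a nonempty set $D$ of atoms is bounded below if some atom $a$ is strictly $\omega$-smaller than all $d\in D$ and $a\le\bigvee D$; a set of atoms is NBB for $\omega$ if it contains no bounded below subset; $I(\cdot)$ denotes the family of sets of atoms NBB for some linear order, so $I((\mathcal L^*)^{opp})$ is a family of subsets of $\mathcal C(\mathcal M)$. $\mathcal S(\mathcal M)=\{\mathcal S\subseteq\mathcal C(\mathcal M):|\mathcal S|\le(n-d)-r_{\mathcal M^*}(\bigcap_{C\in\mathcal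 S}(E\setminus C))\}$ (empty intersection $=E$). A matroid $\mathcal N$ on $\mathcal C(\mathcal M)$ with lattice of flats $\mathcal L(\mathcal N)$ is an adjoint of $\mathcal M$ if the map $E\setminus C\mapsto\mathrm{cl}_{\mathcal N}(\{C\})$ is a bijection from the atoms of $(\mathcal L^*)^{opp}$ onto the atoms of $\mathcal L(\mathcal N)$ and extends to a rank-preserving order embedding $(\mathcal L^*)^{opp}\to\mathcal L(\mathcal N)$. In the weak order, $\mathcal N\le\mathcal N'$ if every basis of $\mathcal N$ is a basis of $\mathcal N'$. -}

module Defs where

open import Data.Nat using (ℕ; zero; suc; _≤_; _<_; _∸_; _⊔_; _≟_)
open import Data.Bool using (Bool; true; false)
open import Data.Fin using (Fin)
open import Data.Fin.Properties using (all?)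
open import Data.Fin.Subset
  using (Subset; ⁅_⁆; _∪_; ∁; ∣_∣; _∈_; _∉_; _⊆_; _⊂_; Nonempty)
  renaming (⊥ to ∅)
open import Data.Fin.Subset.Properties using (_⊆?_; _∈?_; anySubset?)
open import Data.List using (List; []; _∷_; map; _++_; foldr; filter)
open import Data.Vec using (Vec; tabulate; _∷_; [])
open import Data.Product using (Σ; ∃; _×_; _,_)
open import Relation.Nullary using (Dec; ¬_; ¬?)
open import Relation.Nullary.Decidable using (⌊_⌋; _×-dec_; _→-dec_)
open import Relation.Binary.PropositionalEquality using (_≡_)
open import Function using (_⇔_)
open import Function.Definitions using (Injective)

-- Matroids on the ground set Fin n, given by their independent sets
-- (finite ground set; independence is required to be decidable, which
-- classically holds for every predicate on a finite set).

record Matroid (n : ℕ) : Set₁ where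
  field
    Indep    : Subset n → Set
    Indep?   : ∀ X → Dec (Indep X)
    indep-∅  : Indep ∅
    indep-⊆  : ∀ {X Y} → X ⊆ Y → Indep Y → Indep X
    exchange : ∀ {X Y} → Indep X → Indep Y → ∣ X ∣ < ∣ Y ∣ →
               ∃ λ e → e ∈ Y × e ∉ X × Indep (⁅ e ⁆ ∪ X)

open Matroid public

subsets : (n : ℕ) → List (Subset n)
subsets zero    = [] ∷ []
subsets (suc n) = map (true ∷_) (subsets n) ++ map (false ∷_) (subsets n)

rankOf : ∀ {n} {P : Subset n → Set} → (∀ X → Dec (P X)) → Subset n → ℕ
rankOf {n} P? X =
  foldr _⊔_ 0 (map ∣_∣ (filter (λ Y → (Y ⊆? X) ×-dec P? Y) (subsets n)))

IsFlatOf : ∀ {n} → (Subset n → ℕ) → Subset n → Set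
IsFlatOf rk F = ∀ e → e ∉ F → rk F < rk (⁅ e ⁆ ∪ F)

clOf : ∀ {n} → (Subset n → ℕ) → Subset n → Subset n
clOf rk X = tabulate (λ e → ⌊ rk (⁅ e ⁆ ∪ X) ≟ rk X ⌋)

module _ {n : ℕ} (M : Matroid n) where

  rank : Subset n → ℕ
  rank = rankOf (Indep? M)

  IsFlat : Subset n → Set
  IsFlat = IsFlatOf rank

  cl : Subset n → Subset n
  cl = clOf rank

  IsBasis : Subset n → Set
  IsBasis B = Indep M B × (∀ e → e ∉ B → ¬ Indep M (⁅ e ⁆ ∪ B))

  IsBasis? : ∀ B → Dec (IsBasis B)
  IsBasis? B = Indep? M B ×-dec
    all? (λ e → ¬? (e ∈? B) →-dec ¬? (Indep? M (⁅ e ⁆ ∪ B)))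

  IsCircuit : Subset n → Set
  IsCircuit C = ¬ Indep M C × (∀ Y → Y ⊂ C → Indep M Y)

  IndepDual : Subset n → Set
  IndepDual X = ∃ λ B → IsBasis B × X ⊆ ∁ B

  IndepDual? : ∀ X → Dec (IndepDual X)
  IndepDual? X = anySubset? (λ B → IsBasis? B ×-dec (X ⊆? ∁ B))

  rankDual : Subset n → ℕ
  rankDual = rankOf IndepDual?

  IsFlatDual : Subset n → Set
  IsFlatDual = IsFlatOf rankDual

  -- rank function of (L*)^opp : (n - d) - r_{M*}(F),  d = rank M
  rankOpp : Subset n → ℕ
  rankOpp F = (n ∸ rank (Data.Fin.Subset.⊤)) ∸ rankDual F

-- Enumerations of the circuits: the ground set C(M) of the matroids N is
-- represented by Fin m through a bijection c : Fin m → C(M).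

record CircuitEnum {n : ℕ} (M : Matroid n) (m : ℕ) : Set where
  field
    circ     : Fin m → Subset n
    circ-inj : Injective _≡_ _≡_ circ
    circ-ok  : ∀ i → IsCircuit M (circ i)
    circ-all : ∀ C → IsCircuit M C → ∃ λ i → circ i ≡ C

open CircuitEnum public

module _ {n : ℕ} {M : Matroid n} {m : ℕ} (c : CircuitEnum M m) where

  -- ⋂_{i ∈ D} (E ∖ c_i)  (= E for D empty); this is the join of the atoms
  -- E ∖ c_i (i ∈ D) in (L*)^opp, i.e. their meet (intersection) in L*.
  ⋂∁ : Subset m → Subset n
  ⋂∁ D = tabulate (λ e → ⌊ all? (λ i → (i ∈? D) →-dec ¬? (e ∈? circ c i)) ⌋)

  -- order (L*)^opp on atoms: atom a ≤ ⋁ D  iff  ⋁D ⊆ E ∖ c_a  (reverse inclusion)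
  AtomBelowJoin : Fin m → Subset m → Set
  AtomBelowJoin a D = ⋂∁ D ⊆ ∁ (circ c a)

  LinearOrder : Set
  LinearOrder = Σ (Fin m → ℕ) (Injective _≡_ _≡_)

  BoundedBelow : LinearOrder → Subset m → Set
  BoundedBelow (ω , _) D =
    Nonempty D ×
    ∃ λ a → (∀ d → d ∈ D → ω a < ω d) × AtomBelowJoin a D

  NBB : LinearOrder → Subset m → Set
  NBB ω S = ∀ D → D ⊆ S → ¬ BoundedBelow ω D

  InI : Subset m → Set
  InI S = ∃ λ ω → NBB ω S

  InS : Subset m → Set
  InS S = ∣ S ∣ ≤ rankOpp M (⋂∁ S)

  IndepFamily : (Subset m → Set) → Matroid m → Set
  IndepFamily F N = ∀ S → Indep N S ⇔ F S

  IsAdjoint : Matroid m → Set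
  IsAdjoint N =
    -- atoms: E∖C ↦ cl_N{C} is a bijection onto the atoms (rank-1 flats) of L(N)
    Injective _≡_ _≡_ (λ i → cl N ⁅ i ⁆) ×
    (∀ i → IsFlat N (cl N ⁅ i ⁆) × rank N (cl N ⁅ i ⁆) ≡ 1) ×
    (∀ G → IsFlat N G → rank N G ≡ 1 → ∃ λ i → cl N ⁅ i ⁆ ≡ G) ×
    -- and it extends to a rank-preserving order embedding (L*)^opp → L(N)
    (∃ λ (φ : Subset n → Subset m) →
        (∀ i → φ (∁ (circ c i)) ≡ cl N ⁅ i ⁆) ×
        (∀ F → IsFlatDual M F → IsFlat N (φ F)) ×
        (∀ F G → IsFlatDual M F → IsFlatDual M G → (G ⊆ F ⇔ φ F ⊆ φ G)) ×
        (∀ F → IsFlatDual M F → rank N (φ F) ≡ rankOpp M F))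

_≤w_ : ∀ {m} → Matroid m → Matroid m → Set
N ≤w N' = ∀ B → IsBasis N B → IsBasis N' B

module _ {n : ℕ} {M : Matroid n} {m : ℕ} (c : CircuitEnum M m) where

  HasAdjoint : Set₁
  HasAdjoint = Σ (Matroid m) (IsAdjoint c)

  IsMinimalAdjoint : Matroid m → Set₁
  IsMinimalAdjoint N = IsAdjoint c N × (∀ N' → IsAdjoint c N' → N' ≤w N → N ≤w N')

  -- "the maximal adjoint": N is an adjoint and every adjoint lies below it
  IsMaximumAdjoint : Matroid m → Set₁
  IsMaximumAdjoint N = IsAdjoint c N × (∀ N' → IsAdjoint c N' → N' ≤w N)

-- A set S of circuits lies in S(M) iff ∣S∣ is at most the nullity ∣U∣ − r(U) of its union U,
-- since (n − d) − r*(E ∖ U) = ∣U∣ − r(U). An NBB set satisfies this: its least circuit in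
-- the NBB order is not covered by the others and so raises their nullity; hence I ⊆ S.
-- For a flat F of M*, the fundamental circuits of the elements of E ∖ F outside a maximal
-- independent subset of E ∖ F form an NBB set of (n − d) − r*(F) circuits disjoint from F,
-- which stays NBB when any circuit meeting F is put in front. So for every matroid N with
-- I ⊆ Indep N ⊆ S, the set φ(F) of circuits disjoint from F is a flat of rank (n − d) − r*(F),
-- and φ is the required embedding. Conversely every adjoint N′ has I ⊆ Indep N′ (the least
-- element of a circuit of N′ would lie below the join of the others) and Indep N′ ⊆ S, and
-- all adjoints have the same rank; this gives N₁ ≤ N′ ≤ N₂ in the weak order.

module Submission where

open import Defs
open import Data.Nat
  using (ℕ; zero; suc; _+_; _∸_; _⊔_; _≤_; _<_; _≤?_; _<?_; z≤n; s≤s)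
open import Data.Nat.Properties
open import Data.Bool using (true; false)
open import Data.Fin using (Fin; toℕ) renaming (zero to fzero; suc to fsuc)
open import Data.Fin.Properties using (¬∀⟶∃¬; toℕ-injective; toℕ<n; all?)
  renaming (_≟_ to _≟ᶠ_; suc-injective to fsuc-injective)
open import Data.Fin.Subset
  using (Subset; ⁅_⁆; _∪_; _∩_; _─_; _-_; ∁; ∣_∣; _∈_; _∉_; _⊆_; _⊂_; Nonempty; ⊤)
  renaming (⊥ to ∅)
open import Data.Fin.Subset.Properties
open import Data.List using (List; map; filter)
open import Data.List.Membership.Propositional using () renaming (_∈_ to _∈ᴸ_)
open import Data.List.Membership.Propositional.Properties
  using (∈-++⁺ˡ; ∈-++⁺ʳ; ∈-map⁺; ∈-map⁻; ∈-filter⁺; ∈-filter⁻; foldr-selective)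
open import Data.List.Properties using (foldr-preservesᵒ)
import Data.List.Relation.Unary.Any as Any
open import Data.Vec using (_∷_; []; tabulate)
open import Data.Vec.Properties using (lookup∘tabulate; []=⇒lookup; lookup⇒[]=)
open import Data.Vec.Base using (_[_]=_)
open _[_]=_
open import Data.Product using (∃; _×_; _,_; proj₁; proj₂)
open import Data.Sum using (_⊎_; inj₁; inj₂; [_,_]′)
open import Function using (_∘_; _⇔_; mk⇔; Equivalence)
open import Function.Definitions using (Injective)
open import Relation.Nullary using (Dec; yes; no; ¬_; ¬?; contradiction)
open import Relation.Nullary.Decidable using (⌊_⌋; _×-dec_; _→-dec_)
open import Relation.Unary using (Decidable)
open import Relation.Binary.PropositionalEquality
  using (_≡_; _≢_; refl; sym; trans; cong; cong₂; subst; subst₂; module ≡-Reasoning)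
open import Algebra.Properties.CommutativeSemigroup +-commutativeSemigroup using (x∙yz≈y∙xz)

private
  variable
    n k m : ℕ
    p q r : Subset n
    x y : Fin n
    B C F G I U X Y : Subset n

m+n≤o⇒o+p<n+q⇒m+p<q : ∀ {m n o p q} → m + n ≤ o → o + p < n + q → m + p < q
m+n≤o⇒o+p<n+q⇒m+p<q {m} {n} {o} {p} {q} m+n≤o o+p<n+q = +-cancelˡ-< (n + o) (m + p) q (begin-strict
  (n + o) + (m + p)   ≡⟨ x∙yz≈y∙xz (n + o) m p ⟩
  m + ((n + o) + p)   ≡⟨ cong (m +_) (+-assoc n o p) ⟩
  m + (n + (o + p))   ≡⟨ +-assoc m n (o + p) ⟨
  (m + n) + (o + p)   <⟨ +-mono-≤-< m+n≤o o+p<n+q ⟩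
  o + (n + q)         ≡⟨ +-assoc o n q ⟨
  (o + n) + q         ≡⟨ cong (_+ q) (+-comm o n) ⟩
  (n + o) + q         ∎)
  where open ≤-Reasoning

-- Finite subsets

x∈p─q⇒x∉q : x ∈ p ─ q → x ∉ q
x∈p─q⇒x∉q {p = true  ∷ p} {q = false ∷ q} here        ()
x∈p─q⇒x∉q {p = _     ∷ p} {q = _     ∷ q} (there x∈) (there x∈q) = x∈p─q⇒x∉q x∈ x∈q

x∈p-y⇒x≢y : x ∈ p - y → x ≢ y
x∈p-y⇒x≢y {y = y} x∈ refl = x∈p─q⇒x∉q x∈ (x∈⁅x⁆ y)

x∈p-y⇒x∈p : x ∈ p - y → x ∈ p
x∈p-y⇒x∈p {p = p} {y = y} = p─q⊆p p ⁅ y ⁆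

x∈⁅x⁆∪p : x ∈ ⁅ x ⁆ ∪ p
x∈⁅x⁆∪p {x = x} = x∈p∪q⁺ (inj₁ (x∈⁅x⁆ x))

p⊆⁅x⁆∪p : p ⊆ ⁅ x ⁆ ∪ p
p⊆⁅x⁆∪p = x∈p∪q⁺ ∘ inj₂

⁅x⁆∪p⊆q : x ∈ q → p ⊆ q → ⁅ x ⁆ ∪ p ⊆ q
⁅x⁆∪p⊆q {x = x} {p = p} x∈q p⊆q z∈ with x∈p∪q⁻ ⁅ x ⁆ p z∈
... | inj₁ z∈⁅x⁆ = subst (_∈ _) (sym (x∈⁅y⁆⇒x≡y x z∈⁅x⁆)) x∈q
... | inj₂ z∈p   = p⊆q z∈p

⁅x⁆∪-monoʳ : p ⊆ q → ⁅ x ⁆ ∪ p ⊆ ⁅ x ⁆ ∪ q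
⁅x⁆∪-monoʳ p⊆q = ⁅x⁆∪p⊆q x∈⁅x⁆∪p (p⊆⁅x⁆∪p ∘ p⊆q)

⁅x⁆∪p≡p : x ∈ p → ⁅ x ⁆ ∪ p ≡ p
⁅x⁆∪p≡p x∈p = ⊆-antisym (⁅x⁆∪p⊆q x∈p λ y∈p → y∈p) p⊆⁅x⁆∪p

⁅x⁆∪[p-x]≡p : x ∈ p → ⁅ x ⁆ ∪ (p - x) ≡ p
⁅x⁆∪[p-x]≡p {x = x} {p = p} x∈p = ⊆-antisym (⁅x⁆∪p⊆q x∈p x∈p-y⇒x∈p) p⊆
  where
  p⊆ : p ⊆ ⁅ x ⁆ ∪ (p - x)
  p⊆ {y} y∈p with y ≟ᶠ x
  ... | yes refl = x∈⁅x⁆∪p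
  ... | no y≢x   = p⊆⁅x⁆∪p (x∈p∧x≢y⇒x∈p-y y∈p y≢x)

∈∁[⁅x⁆∪p]⁺ : y ∉ p → y ≢ x → y ∈ ∁ (⁅ x ⁆ ∪ p)
∈∁[⁅x⁆∪p]⁺ {p = p} {x = x} y∉p y≢x =
  x∉p⇒x∈∁p ([ x≢y⇒x∉⁅y⁆ y≢x , y∉p ]′ ∘ x∈p∪q⁻ ⁅ x ⁆ p)

∈∁[⁅x⁆∪p]⁻ : y ∈ ∁ (⁅ x ⁆ ∪ p) → y ∉ p × y ≢ x
∈∁[⁅x⁆∪p]⁻ y∈ = x∈∁p⇒x∉p y∈ ∘ p⊆⁅x⁆∪p , λ { refl → x∈∁p⇒x∉p y∈ x∈⁅x⁆∪p }

∁[⁅x⁆∪p]⊆∁p : ∁ (⁅ x ⁆ ∪ p) ⊆ ∁ p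
∁[⁅x⁆∪p]⊆∁p = x∉p⇒x∈∁p ∘ proj₁ ∘ ∈∁[⁅x⁆∪p]⁻

p⊈q⇒∃ : ¬ p ⊆ q → ∃ λ x → x ∈ p × x ∉ q
p⊈q⇒∃ {n} {p} {q} p⊈q
  with ¬∀⟶∃¬ n (λ x → x ∈ p → x ∈ q) (λ x → (x ∈? p) →-dec (x ∈? q)) (λ h → p⊈q (h _))
... | x , ¬[x∈p⇒x∈q] with x ∈? p
...   | yes x∈p = x , x∈p , λ x∈q → ¬[x∈p⇒x∈q] (λ _ → x∈q)
...   | no  x∉p = contradiction (λ x∈p → contradiction x∈p x∉p) ¬[x∈p⇒x∈q]

p⊆q∧∣q∣≤∣p∣⇒q⊆p : p ⊆ q → ∣ q ∣ ≤ ∣ p ∣ → q ⊆ p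
p⊆q∧∣q∣≤∣p∣⇒q⊆p {p = p} p⊆q ∣q∣≤∣p∣ {x} x∈q with x ∈? p
... | yes x∈p = x∈p
... | no  x∉p = contradiction ∣q∣≤∣p∣ (<⇒≱ (p⊂q⇒∣p∣<∣q∣ (p⊆q , x , x∈q , x∉p)))

∣p∪q∣≡∣p∣+∣q∣ : (∀ {x} → x ∈ p → x ∉ q) → ∣ p ∪ q ∣ ≡ ∣ p ∣ + ∣ q ∣
∣p∪q∣≡∣p∣+∣q∣ {p = []}        {q = []}        _    = refl
∣p∪q∣≡∣p∣+∣q∣ {p = true  ∷ p} {q = true  ∷ q} disj = contradiction here (disj here)
∣p∪q∣≡∣p∣+∣q∣ {p = true  ∷ p} {q = false ∷ q} disj =
  cong suc (∣p∪q∣≡∣p∣+∣q∣ (λ x∈p x∈q → disj (there x∈p) (there x∈q)))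
∣p∪q∣≡∣p∣+∣q∣ {p = false ∷ p} {q = true  ∷ q} disj =
  trans (cong suc (∣p∪q∣≡∣p∣+∣q∣ (λ x∈p x∈q → disj (there x∈p) (there x∈q))))
        (sym (+-suc ∣ p ∣ ∣ q ∣))
∣p∪q∣≡∣p∣+∣q∣ {p = false ∷ p} {q = false ∷ q} disj =
  ∣p∪q∣≡∣p∣+∣q∣ (λ x∈p x∈q → disj (there x∈p) (there x∈q))

∣p∣+∣q∣≤∣r∣ : (∀ {x} → x ∈ p → x ∉ q) → p ⊆ r → q ⊆ r → ∣ p ∣ + ∣ q ∣ ≤ ∣ r ∣
∣p∣+∣q∣≤∣r∣ {p = p} {q = q} disj p⊆r q⊆r =
  subst (_≤ _) (∣p∪q∣≡∣p∣+∣q∣ disj) (p⊆q⇒∣p∣≤∣q∣ ([ p⊆r , q⊆r ]′ ∘ x∈p∪q⁻ p q))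

∣⁅x⁆∪p∣≡1+∣p∣ : x ∉ p → ∣ ⁅ x ⁆ ∪ p ∣ ≡ suc ∣ p ∣
∣⁅x⁆∪p∣≡1+∣p∣ {x = x} {p = p} x∉p =
  trans (∣p∪q∣≡∣p∣+∣q∣ λ y∈⁅x⁆ → subst (_∉ p) (sym (x∈⁅y⁆⇒x≡y x y∈⁅x⁆)) x∉p)
        (cong (_+ ∣ p ∣) (∣⁅x⁆∣≡1 x))

∣p∣<∣⁅x⁆∪p∣ : x ∉ p → ∣ p ∣ < ∣ ⁅ x ⁆ ∪ p ∣
∣p∣<∣⁅x⁆∪p∣ x∉p = ≤-reflexive (sym (∣⁅x⁆∪p∣≡1+∣p∣ x∉p))

∣p∣≡1+∣p-x∣ : x ∈ p → ∣ p ∣ ≡ suc ∣ p - x ∣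
∣p∣≡1+∣p-x∣ {x = x} {p = p} x∈p =
  trans (cong ∣_∣ (sym (⁅x⁆∪[p-x]≡p x∈p)))
        (∣⁅x⁆∪p∣≡1+∣p∣ {x = x} {p = p - x} λ x∈ → x∈p-y⇒x≢y {p = p} x∈ refl)

∣p∣≡∣p∩q∣+∣p∩∁q∣ : ∀ (p q : Subset n) → ∣ p ∣ ≡ ∣ p ∩ q ∣ + ∣ p ∩ ∁ q ∣
∣p∣≡∣p∩q∣+∣p∩∁q∣ []         []         = refl
∣p∣≡∣p∩q∣+∣p∩∁q∣ (true  ∷ p) (true  ∷ q) = cong suc (∣p∣≡∣p∩q∣+∣p∩∁q∣ p q)
∣p∣≡∣p∩q∣+∣p∩∁q∣ (true  ∷ p) (false ∷ q) =
  trans (cong suc (∣p∣≡∣p∩q∣+∣p∩∁q∣ p q)) (sym (+-suc _ _))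
∣p∣≡∣p∩q∣+∣p∩∁q∣ (false ∷ p) (_     ∷ q) = ∣p∣≡∣p∩q∣+∣p∩∁q∣ p q

∣p∣+∣∁p∣≡n : ∀ (p : Subset n) → ∣ p ∣ + ∣ ∁ p ∣ ≡ n
∣p∣+∣∁p∣≡n p = trans (cong (∣ p ∣ +_) (∣∁p∣≡n∸∣p∣ p)) (m+[n∸m]≡n (∣p∣≤n p))

x∈p⇒0<∣p∣ : x ∈ p → 0 < ∣ p ∣
x∈p⇒0<∣p∣ {p = true  ∷ p} _           = s≤s z≤n
x∈p⇒0<∣p∣ {p = false ∷ p} (there x∈p) = x∈p⇒0<∣p∣ x∈p

∣p∣≡1⇒p≡⁅x⁆ : ∣ p ∣ ≡ 1 → ∃ λ x → p ≡ ⁅ x ⁆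
∣p∣≡1⇒p≡⁅x⁆ {p = true ∷ p} ∣p∣≡1 =
  fzero , cong (true ∷_) (Empty-unique λ (_ , x∈p) →
    <-irrefl (sym (suc-injective ∣p∣≡1)) (x∈p⇒0<∣p∣ x∈p))
∣p∣≡1⇒p≡⁅x⁆ {p = false ∷ p} ∣p∣≡1 with ∣p∣≡1⇒p≡⁅x⁆ {p = p} ∣p∣≡1
... | x , refl = fsuc x , refl

argmin : (ω : Fin n → ℕ) → Nonempty p → ∃ λ x → x ∈ p × (∀ {y} → y ∈ p → ω x ≤ ω y)
argmin {p = b ∷ p} ω p≢∅ with nonempty? p
argmin {p = true ∷ p} ω _ | no p≡∅ =
  fzero , here , λ { here → ≤-refl ; (there y∈p) → contradiction (_ , y∈p) p≡∅ }
argmin {p = false ∷ p} ω (fzero , ())    | no _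
argmin {p = false ∷ p} ω (fsuc x , there x∈p) | no p≡∅ = contradiction (x , x∈p) p≡∅
argmin {p = b ∷ p} ω _ | yes p≢∅ with argmin (ω ∘ fsuc) p≢∅
argmin {p = false ∷ p} ω _ | yes _ | x , x∈p , min = fsuc x , there x∈p , λ { (there y∈p) → min y∈p }
argmin {p = true  ∷ p} ω _ | yes _ | x , x∈p , min with ω (fsuc x) ≤? ω fzero
... | yes ≤ω₀ = fsuc x , there x∈p , λ { here → ≤ω₀ ; (there y∈p) → min y∈p }
... | no  ≰ω₀ = fzero , here , λ { here → ≤-refl ; (there y∈p) → ≤-trans (<⇒≤ (≰⇒> ≰ω₀)) (min y∈p) }

⌊⌋≡true⇒ : ∀ {A : Set} (a? : Dec A) → ⌊ a? ⌋ ≡ true → A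
⌊⌋≡true⇒ (yes a) _ = a

⇒⌊⌋≡true : ∀ {A : Set} (a? : Dec A) → A → ⌊ a? ⌋ ≡ true
⇒⌊⌋≡true (yes _) _ = refl
⇒⌊⌋≡true (no ¬a) a = contradiction a ¬a

∈-tabulate⌊⌋⁻ : ∀ {P : Fin n → Set} (P? : Decidable P) → x ∈ tabulate (λ y → ⌊ P? y ⌋) → P x
∈-tabulate⌊⌋⁻ {x = x} P? x∈ = ⌊⌋≡true⇒ (P? x) (trans (sym (lookup∘tabulate _ x)) ([]=⇒lookup x∈))

∈-tabulate⌊⌋⁺ : ∀ {P : Fin n → Set} (P? : Decidable P) → P x → x ∈ tabulate (λ y → ⌊ P? y ⌋)
∈-tabulate⌊⌋⁺ {x = x} P? Px = lookup⇒[]= x _ (trans (lookup∘tabulate _ x) (⇒⌊⌋≡true (P? x) Px))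

choose-representatives :
  (A : Subset k) (R : Fin k → Fin m → Set) →
  (∀ {e} → e ∈ A → ∃ (R e)) →
  (∀ {e e′ t} → e ∈ A → e′ ∈ A → R e t → R e′ t → e ≡ e′) →
  ∃ λ S → ∣ A ∣ ≤ ∣ S ∣ × (∀ {t} → t ∈ S → ∃ λ e → e ∈ A × R e t) ×
          (∀ {e t t′} → e ∈ A → t ∈ S → t′ ∈ S → R e t → R e t′ → t ≡ t′)
choose-representatives [] R _ _ = ∅ , z≤n , (λ t∈∅ → contradiction t∈∅ ∉⊥) , λ ()
choose-representatives (b ∷ A) R total functional
  with choose-representatives A (R ∘ fsuc) (total ∘ there)
         (λ e∈A e′∈A r r′ → fsuc-injective (functional (there e∈A) (there e′∈A) r r′))
choose-representatives (false ∷ A) R total functional | S , ∣A∣≤∣S∣ , owner , unique =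
  S , ∣A∣≤∣S∣ , (λ t∈S → let e , e∈A , r = owner t∈S in fsuc e , there e∈A , r) ,
  λ { (there e∈A) → unique e∈A }
choose-representatives {m = m} (true ∷ A) R total functional | S , ∣A∣≤∣S∣ , owner , unique =
  ⁅ t₀ ⁆ ∪ S , subst (suc ∣ A ∣ ≤_) (sym (∣⁅x⁆∪p∣≡1+∣p∣ t₀∉S)) (s≤s ∣A∣≤∣S∣) , owner′ , unique′
  where
  t₀ : Fin m
  t₀ = proj₁ (total here)
  r₀ : R fzero t₀
  r₀ = proj₂ (total here)

  t₀∉S : t₀ ∉ S
  t₀∉S t₀∈S with owner t₀∈S
  ... | e , e∈A , r with functional here (there e∈A) r₀ r
  ... | ()

  owner′ : ∀ {t} → t ∈ ⁅ t₀ ⁆ ∪ S → ∃ λ e → e ∈ true ∷ A × R e t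
  owner′ t∈ with x∈p∪q⁻ ⁅ t₀ ⁆ S t∈
  ... | inj₁ t∈⁅t₀⁆ rewrite x∈⁅y⁆⇒x≡y t₀ t∈⁅t₀⁆ = fzero , here , r₀
  ... | inj₂ t∈S = let e , e∈A , r = owner t∈S in fsuc e , there e∈A , r

  owner-t₀ : ∀ {e t} → e ∈ true ∷ A → t ∈ S → R e t₀ → ¬ R e t
  owner-t₀ e∈ t∈S r r′ with owner t∈S
  ... | e′ , e′∈A , r″ with functional e∈ here r r₀ | functional e∈ (there e′∈A) r′ r″
  ... | refl | ()

  unique′ : ∀ {e t t′} → e ∈ true ∷ A → t ∈ ⁅ t₀ ⁆ ∪ S → t′ ∈ ⁅ t₀ ⁆ ∪ S → R e t → R e t′ → t ≡ t′
  unique′ {e} {t} {t′} e∈ t∈ t′∈ r r′ with x∈p∪q⁻ ⁅ t₀ ⁆ S t∈ | x∈p∪q⁻ ⁅ t₀ ⁆ S t′∈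
  ... | inj₁ t∈⁅t₀⁆ | inj₁ t′∈⁅t₀⁆ = trans (x∈⁅y⁆⇒x≡y t₀ t∈⁅t₀⁆) (sym (x∈⁅y⁆⇒x≡y t₀ t′∈⁅t₀⁆))
  ... | inj₁ t∈⁅t₀⁆ | inj₂ t′∈S    rewrite x∈⁅y⁆⇒x≡y t₀ t∈⁅t₀⁆ = contradiction r′ (owner-t₀ e∈ t′∈S r)
  ... | inj₂ t∈S    | inj₁ t′∈⁅t₀⁆ rewrite x∈⁅y⁆⇒x≡y t₀ t′∈⁅t₀⁆ = contradiction r (owner-t₀ e∈ t∈S r′)
  ... | inj₂ t∈S    | inj₂ t′∈S with owner t∈S
  ...   | e′ , e′∈A , r″ with functional e∈ (there e′∈A) r r″
  ...     | refl = unique e′∈A t∈S t′∈S r r′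

-- Rank functions of decidable families

∈-subsets : ∀ (p : Subset n) → p ∈ᴸ subsets n
∈-subsets []          = Any.here refl
∈-subsets (true  ∷ p) = ∈-++⁺ˡ (∈-map⁺ (true ∷_) (∈-subsets p))
∈-subsets (false ∷ p) = ∈-++⁺ʳ _ (∈-map⁺ (false ∷_) (∈-subsets p))

module _ {P : Subset n → Set} (P? : Decidable P) where

  private
    sizes : Subset n → List ℕ
    sizes X = map ∣_∣ (filter (λ Y → (Y ⊆? X) ×-dec P? Y) (subsets n))

  ∣∣≤rankOf : Y ⊆ X → P Y → ∣ Y ∣ ≤ rankOf P? X
  ∣∣≤rankOf {Y = Y} {X = X} Y⊆X PY = foldr-preservesᵒ ≤-⊔ 0 (sizes X) (inj₂ (Any.map ≤-reflexive ∣Y∣∈))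
    where
    ≤-⊔ : ∀ a b → ∣ Y ∣ ≤ a ⊎ ∣ Y ∣ ≤ b → ∣ Y ∣ ≤ a ⊔ b
    ≤-⊔ a b = [ m≤n⇒m≤n⊔o b , m≤n⇒m≤o⊔n a ]′
    ∣Y∣∈ : ∣ Y ∣ ∈ᴸ sizes X
    ∣Y∣∈ = ∈-map⁺ ∣_∣ (∈-filter⁺ (λ Z → (Z ⊆? X) ×-dec P? Z) (∈-subsets Y) (Y⊆X , PY))

  rankOf-attained : P ∅ → ∀ X → ∃ λ Y → Y ⊆ X × P Y × ∣ Y ∣ ≡ rankOf P? X
  rankOf-attained P∅ X with foldr-selective ⊔-sel 0 (sizes X)
  ... | inj₁ rank≡0 = ∅ , ⊥⊆ , P∅ , trans (∣⊥∣≡0 n) (sym rank≡0)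
  ... | inj₂ rank∈ with ∈-map⁻ ∣_∣ rank∈
  ...   | Y , Y∈ , rank≡∣Y∣ with ∈-filter⁻ (λ Z → (Z ⊆? X) ×-dec P? Z) {xs = subsets n} Y∈
  ...     | _ , Y⊆X , PY = Y , Y⊆X , PY , sym rank≡∣Y∣

-- Rank, closure and circuits of a matroid

module _ (N : Matroid n) where

  indep⇒∣∣≤rank : Y ⊆ X → Indep N Y → ∣ Y ∣ ≤ rank N X
  indep⇒∣∣≤rank = ∣∣≤rankOf (Indep? N)

  rank-attained : ∀ X → ∃ λ Y → Y ⊆ X × Indep N Y × ∣ Y ∣ ≡ rank N X
  rank-attained = rankOf-attained (Indep? N) (indep-∅ N)

  rank-mono : X ⊆ Y → rank N X ≤ rank N Y
  rank-mono {X} X⊆Y with rank-attained X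
  ... | I , I⊆X , indI , ∣I∣≡r = subst (_≤ _) ∣I∣≡r (indep⇒∣∣≤rank (X⊆Y ∘ I⊆X) indI)

  rank≤∣∣ : ∀ X → rank N X ≤ ∣ X ∣
  rank≤∣∣ X with rank-attained X
  ... | I , I⊆X , _ , ∣I∣≡r = subst (_≤ ∣ X ∣) ∣I∣≡r (p⊆q⇒∣p∣≤∣q∣ I⊆X)

  indep⇒rank≡∣∣ : Indep N X → rank N X ≡ ∣ X ∣
  indep⇒rank≡∣∣ indX = ≤-antisym (rank≤∣∣ _) (indep⇒∣∣≤rank (λ x∈ → x∈) indX)

  augment : Indep N I → I ⊆ X → ∣ I ∣ < rank N X →
            ∃ λ e → e ∈ X × e ∉ I × Indep N (⁅ e ⁆ ∪ I)
  augment indI I⊆X ∣I∣<r with rank-attained _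
  ... | Y , Y⊆X , indY , ∣Y∣≡r with exchange N indI indY (subst (_ <_) (sym ∣Y∣≡r) ∣I∣<r)
  ...   | e , e∈Y , e∉I , indeI = e , Y⊆X e∈Y , e∉I , indeI

  extend : Indep N I → I ⊆ X → ∃ λ J → I ⊆ J × J ⊆ X × Indep N J × ∣ J ∣ ≡ rank N X
  extend {X = X} indI I⊆X = go (rank N X) indI I⊆X (m≤m+n (rank N X) _)
    where
    go : ∀ k {I} → Indep N I → I ⊆ X → rank N X ≤ k + ∣ I ∣ →
         ∃ λ J → I ⊆ J × J ⊆ X × Indep N J × ∣ J ∣ ≡ rank N X
    go k {I} indI I⊆X r≤k+∣I∣ with rank N X ≤? ∣ I ∣
    ... | yes r≤∣I∣ = I , (λ x∈ → x∈) , I⊆X , indI , ≤-antisym (indep⇒∣∣≤rank I⊆X indI) r≤∣I∣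
    go zero    indI I⊆X r≤∣I∣ | no r≰∣I∣ = contradiction r≤∣I∣ r≰∣I∣
    go (suc k) indI I⊆X r≤k+∣I∣ | no r≰∣I∣ with augment indI I⊆X (≰⇒> r≰∣I∣)
    ... | e , e∈X , e∉I , indeI with go k indeI (⁅x⁆∪p⊆q e∈X I⊆X)
             (subst (rank N X ≤_) (trans (sym (+-suc k _)) (cong (k +_) (sym (∣⁅x⁆∪p∣≡1+∣p∣ e∉I))))
                    r≤k+∣I∣)
    ...   | J , eI⊆J , J⊆X , indJ , ∣J∣≡r = J , eI⊆J ∘ p⊆⁅x⁆∪p , J⊆X , indJ , ∣J∣≡r

  dependent⇒⊇circuit : ¬ Indep N X → ∃ λ C → C ⊆ X × IsCircuit N C
  dependent⇒⊇circuit {X = X} = go (suc ∣ X ∣) X ≤-refl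
    where
    go : ∀ k X → ∣ X ∣ < k → ¬ Indep N X → ∃ λ C → C ⊆ X × IsCircuit N C
    go (suc k) X ∣X∣<k depX
      with anySubset? {P = λ Y → Y ⊂ X × ¬ Indep N Y} (λ Y → (Y ⊂? X) ×-dec ¬? (Indep? N Y))
    ... | yes (Y , Y⊂X , depY) with go k Y (≤-trans (p⊂q⇒∣p∣<∣q∣ Y⊂X) (≤-pred ∣X∣<k)) depY
    ...   | C , C⊆Y , circC = C , proj₁ Y⊂X ∘ C⊆Y , circC
    go (suc k) X ∣X∣<k depX | no ¬∃dep = X , (λ x∈ → x∈) , depX , properSubsets-indep
      where
      properSubsets-indep : ∀ Y → Y ⊂ X → Indep N Y
      properSubsets-indep Y Y⊂X with Indep? N Y
      ... | yes indY = indY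
      ... | no  depY = contradiction (Y , Y⊂X , depY) ¬∃dep

  maximum⇒insert-dependent : I ⊆ X → ∣ I ∣ ≡ rank N X → x ∈ X → x ∉ I → ¬ Indep N (⁅ x ⁆ ∪ I)
  maximum⇒insert-dependent I⊆X ∣I∣≡r x∈X x∉I indxI =
    contradiction (indep⇒∣∣≤rank (⁅x⁆∪p⊆q x∈X I⊆X) indxI) (<⇒≱ (subst (_< _) ∣I∣≡r (∣p∣<∣⁅x⁆∪p∣ x∉I)))

  fundamental-circuit : Indep N I → ¬ Indep N (⁅ x ⁆ ∪ I) →
                        ∃ λ C → C ⊆ ⁅ x ⁆ ∪ I × x ∈ C × IsCircuit N C
  fundamental-circuit {I = I} {x = x} indI dep with dependent⇒⊇circuit dep
  ... | C , C⊆ , circC with x ∈? C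
  ...   | yes x∈C = C , C⊆ , x∈C , circC
  ...   | no  x∉C = contradiction (indep-⊆ N C⊆I indI) (proj₁ circC)
    where
    C⊆I : C ⊆ I
    C⊆I {y} y∈C with x∈p∪q⁻ ⁅ x ⁆ I (C⊆ y∈C)
    ... | inj₁ y∈⁅x⁆ = contradiction (subst (_∈ C) (x∈⁅y⁆⇒x≡y x y∈⁅x⁆) y∈C) x∉C
    ... | inj₂ y∈I   = y∈I

  ∈cl⁻ : x ∈ cl N X → rank N (⁅ x ⁆ ∪ X) ≡ rank N X
  ∈cl⁻ {X = X} = ∈-tabulate⌊⌋⁻ (λ y → rank N (⁅ y ⁆ ∪ X) Data.Nat.≟ rank N X)

  ∈cl⁺ : rank N (⁅ x ⁆ ∪ X) ≡ rank N X → x ∈ cl N X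
  ∈cl⁺ {X = X} = ∈-tabulate⌊⌋⁺ (λ y → rank N (⁅ y ⁆ ∪ X) Data.Nat.≟ rank N X)

  ⊆cl : X ⊆ cl N X
  ⊆cl x∈X = ∈cl⁺ (cong (rank N) (⁅x⁆∪p≡p x∈X))

  rank-cl≤rank : ∀ X → rank N (cl N X) ≤ rank N X
  rank-cl≤rank X with rank N (cl N X) ≤? rank N X
  ... | yes r≤ = r≤
  ... | no  r≰ with rank-attained X
  ...   | I , I⊆X , indI , ∣I∣≡r with augment indI (⊆cl ∘ I⊆X) (subst (_< _) (sym ∣I∣≡r) (≰⇒> r≰))
  ...     | e , e∈cl , e∉I , indeI = contradiction indeI
              (maximum⇒insert-dependent (p⊆⁅x⁆∪p ∘ I⊆X) (trans ∣I∣≡r (sym (∈cl⁻ e∈cl))) x∈⁅x⁆∪p e∉I)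

  spanned⇒∈flat : rank N (⁅ x ⁆ ∪ X) ≡ rank N X → X ⊆ G → IsFlat N G → x ∈ G
  spanned⇒∈flat {x = x} {X = X} {G = G} spanned X⊆G flatG with x ∈? G
  ... | yes x∈G = x∈G
  ... | no  x∉G with rank-attained X
  ...   | I , I⊆X , indI , ∣I∣≡rX with extend indI (X⊆G ∘ I⊆X)
  ...     | J , I⊆J , J⊆G , indJ , ∣J∣≡rG
            with augment indJ (p⊆⁅x⁆∪p ∘ J⊆G) (subst (_< _) (sym ∣J∣≡rG) (flatG x x∉G))
  ...       | f , f∈xG , f∉J , indfJ with x∈p∪q⁻ ⁅ x ⁆ G f∈xG
  ...         | inj₂ f∈G = contradiction indfJ (maximum⇒insert-dependent J⊆G ∣J∣≡rG f∈G f∉J)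
  ...         | inj₁ f∈⁅x⁆ with x∈⁅y⁆⇒x≡y x f∈⁅x⁆
  ...           | refl = contradiction (indep-⊆ N (⁅x⁆∪-monoʳ I⊆J) indfJ)
                           (maximum⇒insert-dependent (p⊆⁅x⁆∪p ∘ I⊆X) (trans ∣I∣≡rX (sym spanned))
                                                     x∈⁅x⁆∪p (f∉J ∘ I⊆J))

  cl⊆flat : X ⊆ G → IsFlat N G → cl N X ⊆ G
  cl⊆flat X⊆G flatG x∈cl = spanned⇒∈flat (∈cl⁻ x∈cl) X⊆G flatG

  flat⊆∧rank≤⇒⊇ : IsFlat N F → F ⊆ G → rank N G ≤ rank N F → G ⊆ F
  flat⊆∧rank≤⇒⊇ {F = F} flatF F⊆G rG≤rF {x} x∈G with x ∈? F
  ... | yes x∈F = x∈F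
  ... | no  x∉F = contradiction (≤-trans (rank-mono (⁅x⁆∪p⊆q x∈G F⊆G)) rG≤rF) (<⇒≱ (flatF x x∉F))

  circuit-nonempty : IsCircuit N C → Nonempty C
  circuit-nonempty {C = C} (depC , _) with nonempty? C
  ... | yes C≢∅ = C≢∅
  ... | no  C≡∅ = contradiction (subst (Indep N) (sym (Empty-unique C≡∅)) (indep-∅ N)) depC

  circuit-minus-indep : IsCircuit N C → x ∈ C → Indep N (C - x)
  circuit-minus-indep {C = C} {x = x} (_ , minC) x∈C =
    minC (C - x) (x∈p-y⇒x∈p , x , x∈C , λ x∈ → x∈p-y⇒x≢y {p = C} x∈ refl)

  circuit-spanned : IsCircuit N C → x ∈ C → rank N (⁅ x ⁆ ∪ (C - x)) ≡ rank N (C - x)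
  circuit-spanned {C = C} {x = x} circC x∈C =
    ≤-antisym (subst (λ Z → rank N Z ≤ rank N (C - x)) (sym (⁅x⁆∪[p-x]≡p x∈C)) rC≤)
              (rank-mono p⊆⁅x⁆∪p)
    where
    rC≤ : rank N C ≤ rank N (C - x)
    rC≤ with rank-attained C
    ... | Y , Y⊆C , indY , ∣Y∣≡rC with ∣ Y ∣ ≤? ∣ C - x ∣
    ...   | yes ∣Y∣≤ = subst₂ _≤_ ∣Y∣≡rC (sym (indep⇒rank≡∣∣ (circuit-minus-indep circC x∈C))) ∣Y∣≤
    ...   | no  ∣Y∣≰ = contradiction (indep-⊆ N C⊆Y indY) (proj₁ circC)
      where
      C⊆Y : C ⊆ Y
      C⊆Y = p⊆q∧∣q∣≤∣p∣⇒q⊆p Y⊆C (subst (_≤ _) (sym (∣p∣≡1+∣p-x∣ x∈C)) (≰⇒> ∣Y∣≰))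

  circuit-avoiding-maxIndep : IsCircuit N C → x ∈ C → C ⊆ X →
                              ∃ λ J → J ⊆ X × Indep N J × ∣ J ∣ ≡ rank N X × x ∉ J
  circuit-avoiding-maxIndep {C = C} {x = x} circC x∈C C⊆X
    with extend (circuit-minus-indep circC x∈C) (C⊆X ∘ x∈p-y⇒x∈p)
  ... | J , C-x⊆J , J⊆X , indJ , ∣J∣≡r = J , J⊆X , indJ , ∣J∣≡r , λ x∈J →
        proj₁ circC (indep-⊆ N (subst (_⊆ J) (⁅x⁆∪[p-x]≡p x∈C) (⁅x⁆∪p⊆q x∈J C-x⊆J)) indJ)

  circuit-raises-nullity : IsCircuit N C → x ∈ C → x ∉ U →
                           ∣ U ∣ + rank N (U ∪ C) < rank N U + ∣ U ∪ C ∣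
  circuit-raises-nullity {C = C} {x = x} {U = U} circC x∈C x∉U
    with circuit-avoiding-maxIndep circC x∈C (q⊆p∪q U C)
  ... | J , J⊆W , indJ , ∣J∣≡rW , x∉J = begin-strict
    ∣ U ∣ + rank N W                          ≡⟨ cong (∣ U ∣ +_) ∣J∣-split ⟩
    ∣ U ∣ + (∣ J ∩ U ∣ + ∣ J ∩ ∁ U ∣)         <⟨ +-mono-≤-< ∣U∣≤ (+-mono-≤-< ∣J∩U∣≤ ∣J∩∁U∣<) ⟩
    ∣ W ∩ U ∣ + (rank N U + ∣ W ∩ ∁ U ∣)      ≡⟨ x∙yz≈y∙xz ∣ W ∩ U ∣ (rank N U) _ ⟩
    rank N U + (∣ W ∩ U ∣ + ∣ W ∩ ∁ U ∣)      ≡⟨ cong (rank N U +_) (sym (∣p∣≡∣p∩q∣+∣p∩∁q∣ W U)) ⟩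
    rank N U + ∣ W ∣                          ∎
    where
    open ≤-Reasoning
    W : Subset n
    W = U ∪ C
    ∣J∣-split : rank N W ≡ ∣ J ∩ U ∣ + ∣ J ∩ ∁ U ∣
    ∣J∣-split = trans (sym ∣J∣≡rW) (∣p∣≡∣p∩q∣+∣p∩∁q∣ J U)
    ∣U∣≤ : ∣ U ∣ ≤ ∣ W ∩ U ∣
    ∣U∣≤ = p⊆q⇒∣p∣≤∣q∣ {p = U} λ y∈U → x∈p∩q⁺ (p⊆p∪q C y∈U , y∈U)
    ∣J∩U∣≤ : ∣ J ∩ U ∣ ≤ rank N U
    ∣J∩U∣≤ = indep⇒∣∣≤rank (p∩q⊆q J U) (indep-⊆ N (p∩q⊆p J U) indJ)
    ∣J∩∁U∣< : ∣ J ∩ ∁ U ∣ < ∣ W ∩ ∁ U ∣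
    ∣J∩∁U∣< = <-≤-trans (∣p∣<∣⁅x⁆∪p∣ (x∉J ∘ p∩q⊆p J (∁ U)))
      (p⊆q⇒∣p∣≤∣q∣ (⁅x⁆∪p⊆q (x∈p∩q⁺ (q⊆p∪q U C x∈C , x∉p⇒x∈∁p x∉U))
                              (λ y∈ → x∈p∩q⁺ (J⊆W (p∩q⊆p J (∁ U) y∈) , p∩q⊆q J (∁ U) y∈))))

-- The dual matroid

IsUnionOfCircuits : Matroid n → Subset n → Set
IsUnionOfCircuits M U = ∀ {x} → x ∈ U → ∃ λ C → IsCircuit M C × C ⊆ U × x ∈ C

module _ (M : Matroid n) where

  basis⇒∣∣≡rank⊤ : IsBasis M B → ∣ B ∣ ≡ rank M ⊤
  basis⇒∣∣≡rank⊤ {B = B} (indB , maxB) with ∣ B ∣ <? rank M ⊤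
  ... | yes ∣B∣<r with augment M indB ⊆⊤ ∣B∣<r
  ...   | x , _ , x∉B , indxB = contradiction indxB (maxB x x∉B)
  basis⇒∣∣≡rank⊤ (indB , _) | no ∣B∣≮r = ≤-antisym (indep⇒∣∣≤rank M ⊆⊤ indB) (≮⇒≥ ∣B∣≮r)

  indep∧∣∣≡rank⊤⇒basis : Indep M B → ∣ B ∣ ≡ rank M ⊤ → IsBasis M B
  indep∧∣∣≡rank⊤⇒basis indB ∣B∣≡r = indB , λ x x∉B → maximum⇒insert-dependent M ⊆⊤ ∣B∣≡r ∈⊤ x∉B

  basis-exists : ∃ λ B → IsBasis M B
  basis-exists with extend M (indep-∅ M) (⊆⊤ {p = ∅})
  ... | B , _ , _ , indB , ∣B∣≡r = B , indep∧∣∣≡rank⊤⇒basis indB ∣B∣≡r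

  private
    d : ℕ
    d = rank M ⊤

    indepDual-∅ : IndepDual M ∅
    indepDual-∅ = proj₁ basis-exists , proj₂ basis-exists , ⊥⊆

  rankDual-lower : ∀ X → ∣ X ∣ + rank M (∁ X) ≤ rankDual M X + d
  rankDual-lower X with rank-attained M (∁ X)
  ... | I , I⊆∁X , indI , ∣I∣≡r with extend M indI (⊆⊤ {p = I})
  ...   | B , I⊆B , _ , indB , ∣B∣≡d = begin
    ∣ X ∣ + rank M (∁ X)                   ≡⟨ cong₂ _+_ (∣p∣≡∣p∩q∣+∣p∩∁q∣ X B) (sym ∣I∣≡r) ⟩
    (∣ X ∩ B ∣ + ∣ X ∩ ∁ B ∣) + ∣ I ∣      ≡⟨ +-assoc ∣ X ∩ B ∣ _ _ ⟩
    ∣ X ∩ B ∣ + (∣ X ∩ ∁ B ∣ + ∣ I ∣)      ≡⟨ cong (∣ X ∩ B ∣ +_) (+-comm ∣ X ∩ ∁ B ∣ ∣ I ∣) ⟩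
    ∣ X ∩ B ∣ + (∣ I ∣ + ∣ X ∩ ∁ B ∣)      ≡⟨ +-assoc ∣ X ∩ B ∣ _ _ ⟨
    (∣ X ∩ B ∣ + ∣ I ∣) + ∣ X ∩ ∁ B ∣      ≤⟨ +-mono-≤ ∣X∩B∣+∣I∣≤d ∣X∩∁B∣≤r* ⟩
    d + rankDual M X                       ≡⟨ +-comm d _ ⟩
    rankDual M X + d                       ∎
    where
    open ≤-Reasoning
    ∣X∩B∣+∣I∣≤d : ∣ X ∩ B ∣ + ∣ I ∣ ≤ d
    ∣X∩B∣+∣I∣≤d = subst (_ ≤_) ∣B∣≡d
      (∣p∣+∣q∣≤∣r∣ (λ y∈X∩B y∈I → x∈∁p⇒x∉p (I⊆∁X y∈I) (p∩q⊆p X B y∈X∩B)) (p∩q⊆q X B) I⊆B)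
    ∣X∩∁B∣≤r* : ∣ X ∩ ∁ B ∣ ≤ rankDual M X
    ∣X∩∁B∣≤r* = ∣∣≤rankOf (IndepDual? M) (p∩q⊆p X (∁ B))
                  (B , indep∧∣∣≡rank⊤⇒basis indB ∣B∣≡d , p∩q⊆q X (∁ B))

  rankDual-upper : ∀ X → rankDual M X + d ≤ ∣ X ∣ + rank M (∁ X)
  rankDual-upper X with rankOf-attained (IndepDual? M) indepDual-∅ X
  ... | Y , Y⊆X , (B , basisB , Y⊆∁B) , ∣Y∣≡r* = begin
    rankDual M X + d                       ≡⟨ cong₂ _+_ (sym ∣Y∣≡r*) ∣B∣-split ⟩
    ∣ Y ∣ + (∣ B ∩ X ∣ + ∣ B ∩ ∁ X ∣)      ≡⟨ +-assoc ∣ Y ∣ _ _ ⟨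
    (∣ Y ∣ + ∣ B ∩ X ∣) + ∣ B ∩ ∁ X ∣      ≤⟨ +-mono-≤ ∣Y∣+∣B∩X∣≤∣X∣ ∣B∩∁X∣≤r ⟩
    ∣ X ∣ + rank M (∁ X)                   ∎
    where
    open ≤-Reasoning
    ∣B∣-split : d ≡ ∣ B ∩ X ∣ + ∣ B ∩ ∁ X ∣
    ∣B∣-split = trans (sym (basis⇒∣∣≡rank⊤ basisB)) (∣p∣≡∣p∩q∣+∣p∩∁q∣ B X)
    ∣Y∣+∣B∩X∣≤∣X∣ : ∣ Y ∣ + ∣ B ∩ X ∣ ≤ ∣ X ∣
    ∣Y∣+∣B∩X∣≤∣X∣ = ∣p∣+∣q∣≤∣r∣ (λ y∈Y y∈B∩X → x∈∁p⇒x∉p (Y⊆∁B y∈Y) (p∩q⊆p B X y∈B∩X)) Y⊆X (p∩q⊆q B X)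
    ∣B∩∁X∣≤r : ∣ B ∩ ∁ X ∣ ≤ rank M (∁ X)
    ∣B∩∁X∣≤r = indep⇒∣∣≤rank M (p∩q⊆q B (∁ X)) (indep-⊆ M (p∩q⊆p B (∁ X)) (proj₁ basisB))

  rankDual+rank⊤≡∣∣+rank∁ : ∀ X → rankDual M X + rank M ⊤ ≡ ∣ X ∣ + rank M (∁ X)
  rankDual+rank⊤≡∣∣+rank∁ X = ≤-antisym (rankDual-upper X) (rankDual-lower X)

  rankDual-mono : X ⊆ Y → rankDual M X ≤ rankDual M Y
  rankDual-mono {X = X} X⊆Y with rankOf-attained (IndepDual? M) indepDual-∅ X
  ... | I , I⊆X , indI , ∣I∣≡r* = subst (_≤ _) ∣I∣≡r* (∣∣≤rankOf (IndepDual? M) (X⊆Y ∘ I⊆X) indI)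

  rankOpp≡∣∁∣∸rank∁ : ∀ F → rankOpp M F ≡ ∣ ∁ F ∣ ∸ rank M (∁ F)
  rankOpp≡∣∁∣∸rank∁ F = begin
    (n ∸ d) ∸ rankDual M F                 ≡⟨ ∸-+-assoc n d (rankDual M F) ⟩
    n ∸ (d + rankDual M F)                 ≡⟨ cong₂ _∸_ (sym (∣p∣+∣∁p∣≡n F))
                                                   (trans (+-comm d _) (rankDual+rank⊤≡∣∣+rank∁ F)) ⟩
    (∣ F ∣ + ∣ ∁ F ∣) ∸ (∣ F ∣ + rank M (∁ F)) ≡⟨ [m+n]∸[m+o]≡n∸o ∣ F ∣ ∣ ∁ F ∣ (rank M (∁ F)) ⟩
    ∣ ∁ F ∣ ∸ rank M (∁ F)                 ∎
    where open ≡-Reasoning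

  private
    rankDual-insert : x ∉ F → rankDual M (⁅ x ⁆ ∪ F) + d ≡ suc (∣ F ∣ + rank M (∁ (⁅ x ⁆ ∪ F)))
    rankDual-insert {x = x} {F = F} x∉F =
      trans (rankDual+rank⊤≡∣∣+rank∁ _) (cong (_+ rank M (∁ (⁅ x ⁆ ∪ F))) (∣⁅x⁆∪p∣≡1+∣p∣ x∉F))

  rankDual-<⇒rank∁-≤ : x ∉ F → rankDual M F < rankDual M (⁅ x ⁆ ∪ F) →
                       rank M (∁ F) ≤ rank M (∁ (⁅ x ⁆ ∪ F))
  rankDual-<⇒rank∁-≤ {F = F} x∉F r*< = +-cancelˡ-≤ ∣ F ∣ _ _ (≤-pred
    (subst₂ _≤_ (cong suc (rankDual+rank⊤≡∣∣+rank∁ F)) (rankDual-insert x∉F) (+-monoˡ-≤ d r*<)))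

  rank∁-≤⇒rankDual-< : x ∉ F → rank M (∁ F) ≤ rank M (∁ (⁅ x ⁆ ∪ F)) →
                       rankDual M F < rankDual M (⁅ x ⁆ ∪ F)
  rank∁-≤⇒rankDual-< {F = F} x∉F r≤ = +-cancelʳ-< d _ _
    (subst₂ _<_ (sym (rankDual+rank⊤≡∣∣+rank∁ F)) (sym (rankDual-insert x∉F)) (s≤s (+-monoʳ-≤ ∣ F ∣ r≤)))

  flatDual-insert-dependent : IsFlatDual M F → x ∈ ∁ F → I ⊆ ∁ (⁅ x ⁆ ∪ F) →
                              ∣ I ∣ ≡ rank M (∁ (⁅ x ⁆ ∪ F)) → ¬ Indep M (⁅ x ⁆ ∪ I)
  flatDual-insert-dependent {F = F} {x = x} flatF x∈∁F I⊆V ∣I∣≡rV indxI =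
    contradiction (≤-trans (indep⇒∣∣≤rank M (⁅x⁆∪p⊆q x∈∁F (∁[⁅x⁆∪p]⊆∁p ∘ I⊆V)) indxI) r∁F≤rV)
                  (<⇒≱ (subst (_< _) ∣I∣≡rV (∣p∣<∣⁅x⁆∪p∣ λ x∈I → proj₂ (∈∁[⁅x⁆∪p]⁻ (I⊆V x∈I)) refl)))
    where
    x∉F : x ∉ F
    x∉F = x∈∁p⇒x∉p x∈∁F
    r∁F≤rV : rank M (∁ F) ≤ rank M (∁ (⁅ x ⁆ ∪ F))
    r∁F≤rV = rankDual-<⇒rank∁-≤ x∉F (flatF x x∉F)

  flatDual⇒unionOfCircuits : IsFlatDual M F → IsUnionOfCircuits M (∁ F)
  flatDual⇒unionOfCircuits {F = F} flatF {x} x∈∁F =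
    let I , I⊆V , indI , ∣I∣≡rV = rank-attained M (∁ (⁅ x ⁆ ∪ F))
        C , C⊆xI , x∈C , circC  =
          fundamental-circuit M indI (flatDual-insert-dependent flatF x∈∁F I⊆V ∣I∣≡rV)
    in C , circC , ⁅x⁆∪p⊆q x∈∁F (∁[⁅x⁆∪p]⊆∁p ∘ I⊆V) ∘ C⊆xI , x∈C

  unionOfCircuits⇒flatDual : IsUnionOfCircuits M (∁ F) → IsFlatDual M F
  unionOfCircuits⇒flatDual {F = F} ∪circ x x∉F with ∪circ (x∉p⇒x∈∁p x∉F)
  ... | C , circC , C⊆∁F , x∈C with circuit-avoiding-maxIndep M circC x∈C C⊆∁F
  ...   | J , J⊆∁F , indJ , ∣J∣≡r , x∉J = rank∁-≤⇒rankDual-< x∉F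
          (subst (_≤ _) ∣J∣≡r (indep⇒∣∣≤rank M J⊆V indJ))
    where
    J⊆V : J ⊆ ∁ (⁅ x ⁆ ∪ F)
    J⊆V y∈J = ∈∁[⁅x⁆∪p]⁺ (x∈∁p⇒x∉p (J⊆∁F y∈J)) λ { refl → x∉J y∈J }

  rankOpp-antitone : X ⊆ Y → rankOpp M Y ≤ rankOpp M X
  rankOpp-antitone X⊆Y = ∸-monoʳ-≤ (n ∸ d) (rankDual-mono X⊆Y)

-- Circuits as atoms of (L*)^opp

module _ {n : ℕ} {M : Matroid n} {m : ℕ} (c : CircuitEnum M m) where

  private
    variable
      D S T : Subset m
      i j s t : Fin m

  ⋃circ : Subset m → Subset n
  ⋃circ D = ∁ (⋂∁ c D)

  ∈⋂∁⁻ : x ∈ ⋂∁ c D → i ∈ D → x ∉ circ c i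
  ∈⋂∁⁻ {x = x} {D = D} x∈ = ∈-tabulate⌊⌋⁻ (λ y → all? λ i → (i ∈? D) →-dec ¬? (y ∈? circ c i)) x∈ _

  ∈⋂∁⁺ : (∀ {i} → i ∈ D → x ∉ circ c i) → x ∈ ⋂∁ c D
  ∈⋂∁⁺ {D = D} h = ∈-tabulate⌊⌋⁺ (λ y → all? λ i → (i ∈? D) →-dec ¬? (y ∈? circ c i)) (λ _ → h)

  ∈⋃circ⁺ : i ∈ D → x ∈ circ c i → x ∈ ⋃circ D
  ∈⋃circ⁺ i∈D x∈ci = x∉p⇒x∈∁p λ x∈⋂ → ∈⋂∁⁻ x∈⋂ i∈D x∈ci

  ∈⋃circ⁻ : x ∈ ⋃circ D → ∃ λ i → i ∈ D × x ∈ circ c i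
  ∈⋃circ⁻ {x = x} {D = D} x∈⋃
    with ¬∀⟶∃¬ m (λ i → i ∈ D → x ∉ circ c i) (λ i → (i ∈? D) →-dec ¬? (x ∈? circ c i))
               (λ h → x∈∁p⇒x∉p x∈⋃ (∈⋂∁⁺ (h _)))
  ... | i , ¬h with i ∈? D | x ∈? circ c i
  ...   | yes i∈D | yes x∈ci = i , i∈D , x∈ci
  ...   | yes _   | no  x∉ci = contradiction (λ _ → x∉ci) ¬h
  ...   | no  i∉D | _        = contradiction (λ i∈D → contradiction i∈D i∉D) ¬h

  ⋃circ-remove : s ∈ S → ⋃circ S ≡ ⋃circ (S - s) ∪ circ c s
  ⋃circ-remove {s = s} {S = S} s∈S = ⊆-antisym ⊆∪ (λ x∈ → [ ⋃-mono , ∈⋃circ⁺ s∈S ]′ (x∈p∪q⁻ _ _ x∈))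
    where
    ⋃-mono : ⋃circ (S - s) ⊆ ⋃circ S
    ⋃-mono x∈ = let i , i∈ , x∈ci = ∈⋃circ⁻ x∈ in ∈⋃circ⁺ (x∈p-y⇒x∈p i∈) x∈ci
    ⊆∪ : ⋃circ S ⊆ ⋃circ (S - s) ∪ circ c s
    ⊆∪ x∈ with ∈⋃circ⁻ x∈
    ... | i , i∈S , x∈ci with i ≟ᶠ s
    ...   | yes refl = x∈p∪q⁺ (inj₂ x∈ci)
    ...   | no  i≢s  = x∈p∪q⁺ (inj₁ (∈⋃circ⁺ (x∈p∧x≢y⇒x∈p-y i∈S i≢s) x∈ci))

  ⋂∁-flatDual : ∀ D → IsFlatDual M (⋂∁ c D)
  ⋂∁-flatDual D = unionOfCircuits⇒flatDual M λ x∈ →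
    let i , i∈D , x∈ci = ∈⋃circ⁻ x∈ in circ c i , circ-ok c i , ∈⋃circ⁺ i∈D , x∈ci

  ∁circ-flatDual : ∀ i → IsFlatDual M (∁ (circ c i))
  ∁circ-flatDual i = unionOfCircuits⇒flatDual M λ x∈ →
    circ c i , circ-ok c i , x∉p⇒x∈∁p ∘ x∈p⇒x∉∁p , x∉∁p⇒x∈p (x∈∁p⇒x∉p x∈)

  flatDual-∉⇒circ : IsFlatDual M F → x ∉ F → ∃ λ t → circ c t ⊆ ∁ F × x ∈ circ c t
  flatDual-∉⇒circ flatF x∉F =
    let C , circC , C⊆∁F , x∈C = flatDual⇒unionOfCircuits M flatF (x∉p⇒x∈∁p x∉F)
        t , ct≡C = circ-all c C circC
    in t , subst (_⊆ _) (sym ct≡C) C⊆∁F , subst (_ ∈_) (sym ct≡C) x∈C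

  circ-⊆⇒≡ : circ c i ⊆ circ c j → i ≡ j
  circ-⊆⇒≡ {i} {j} ci⊆cj with circ c j ⊆? circ c i
  ... | yes cj⊆ci = circ-inj c (⊆-antisym ci⊆cj cj⊆ci)
  ... | no  cj⊈ci with p⊈q⇒∃ cj⊈ci
  ...   | x , x∈cj , x∉ci =
          contradiction (proj₂ (circ-ok c j) (circ c i) (ci⊆cj , x , x∈cj , x∉ci)) (proj₁ (circ-ok c i))

  -- NBB sets

  Prefixes : LinearOrder c → Subset m → Set
  Prefixes (ω , _) T = ∀ {t x} → t ∈ T → x ∉ T → ω t < ω x

  prefixing : Subset m → LinearOrder c
  prefixing T = ω , ω-injective
    where
    ω : Fin m → ℕ
    ω x with x ∈? T
    ... | yes _ = toℕ x
    ... | no  _ = m + toℕ x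
    ω-injective : Injective _≡_ _≡_ ω
    ω-injective {x} {y} ωx≡ωy with x ∈? T | y ∈? T
    ... | yes _ | yes _ = toℕ-injective ωx≡ωy
    ... | no  _ | no  _ = toℕ-injective (+-cancelˡ-≡ m _ _ ωx≡ωy)
    ... | yes _ | no  _ = contradiction ωx≡ωy (<⇒≢ (<-≤-trans (toℕ<n x) (m≤m+n m (toℕ y))))
    ... | no  _ | yes _ = contradiction (sym ωx≡ωy) (<⇒≢ (<-≤-trans (toℕ<n y) (m≤m+n m (toℕ x))))

  prefixing-prefixes : ∀ T → Prefixes (prefixing T) T
  prefixing-prefixes T {t} {x} t∈T x∉T with t ∈? T | x ∈? T
  ... | yes _   | no _    = <-≤-trans (toℕ<n t) (m≤m+n m (toℕ x))
  ... | no  t∉T | _       = contradiction t∈T t∉T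
  ... | _       | yes x∈T = contradiction x∈T x∉T

  toFront : Fin m → LinearOrder c → LinearOrder c
  toFront s (ω , ω-injective) = ω′ , ω′-injective
    where
    ω′ : Fin m → ℕ
    ω′ x with x ≟ᶠ s
    ... | yes _ = 0
    ... | no  _ = suc (ω x)
    ω′-injective : Injective _≡_ _≡_ ω′
    ω′-injective {x} {y} ω′x≡ω′y with x ≟ᶠ s | y ≟ᶠ s
    ... | yes x≡s | yes y≡s = trans x≡s (sym y≡s)
    ... | no  _   | no  _   = ω-injective (suc-injective ω′x≡ω′y)

  toFront-first : ∀ s ω → proj₁ (toFront s ω) s ≡ 0
  toFront-first s ω with s ≟ᶠ s
  ... | yes _   = refl
  ... | no  s≢s = contradiction refl s≢s

  toFront-prefixes : ∀ ω → Prefixes ω T → s ∈ T → Prefixes (toFront s ω) T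
  toFront-prefixes {s = s} _ prefixes s∈T {t} {x} t∈T x∉T with t ≟ᶠ s | x ≟ᶠ s
  ... | _     | yes refl = contradiction s∈T x∉T
  ... | yes _ | no  _    = s≤s z≤n
  ... | no  _ | no  _    = s≤s (prefixes t∈T x∉T)

  PrivateAfter : LinearOrder c → Subset m → Fin m → Set
  PrivateAfter (ω , _) T a = ∃ λ x → x ∈ circ c a × (∀ {t} → t ∈ T → ω a < ω t → x ∉ circ c t)

  atomBelowJoin⇒circ⊆⋃circ : AtomBelowJoin c i D → circ c i ⊆ ⋃circ D
  atomBelowJoin⇒circ⊆⋃circ i≤⋁D x∈ci = x∉p⇒x∈∁p λ x∈⋂ → x∈∁p⇒x∉p (i≤⋁D x∈⋂) x∈ci

  circ⊆⋃circ⇒atomBelowJoin : circ c i ⊆ ⋃circ D → AtomBelowJoin c i D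
  circ⊆⋃circ⇒atomBelowJoin ci⊆⋃D x∈⋂ = x∉p⇒x∈∁p λ x∈ci → x∈∁p⇒x∉p (ci⊆⋃D x∈ci) x∈⋂

  privateAfter⇒NBB : ∀ ω → Prefixes ω T → (∀ {a} → a ∈ T → PrivateAfter ω T a) → NBB c ω T
  privateAfter⇒NBB {T = T} (ω , _) prefixes priv D D⊆T ((d₀ , d₀∈D) , a , a<D , a≤⋁D) with a ∈? T
  ... | no  a∉T = <-asym (a<D d₀ d₀∈D) (prefixes (D⊆T d₀∈D) a∉T)
  ... | yes a∈T with priv a∈T
  ...   | x , x∈ca , later with ∈⋃circ⁻ (atomBelowJoin⇒circ⊆⋃circ a≤⋁D x∈ca)
  ...     | d , d∈D , x∈cd = later (D⊆T d∈D) (a<D d d∈D) x∈cd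

  HasPrivateElements : Subset m → Set
  HasPrivateElements S = ∀ {a} → a ∈ S → ∃ λ x → x ∈ circ c a × (∀ {t} → t ∈ S → x ∈ circ c t → t ≡ a)

  singleton-private : ∀ i → HasPrivateElements ⁅ i ⁆
  singleton-private i a∈⁅i⁆ with circuit-nonempty M (circ-ok c _)
  ... | x , x∈ca = x , x∈ca , λ t∈⁅i⁆ _ → trans (x∈⁅y⁆⇒x≡y i t∈⁅i⁆) (sym (x∈⁅y⁆⇒x≡y i a∈⁅i⁆))

  private⇒InI : HasPrivateElements S → InI c S
  private⇒InI {S} priv = ω , privateAfter⇒NBB ω (prefixing-prefixes S) privateAfter
    where
    ω : LinearOrder c
    ω = prefixing S
    privateAfter : ∀ {a} → a ∈ S → PrivateAfter ω S a
    privateAfter a∈S with priv a∈S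
    ... | x , x∈ca , only = x , x∈ca , λ t∈S ωa<ωt x∈ct →
          <-irrefl (cong (proj₁ ω) (sym (only t∈S x∈ct))) ωa<ωt

  -- With i in front, the element x ∉ U of its circuit is private, and the circuits of S keep theirs.
  private⇒InI-insert : HasPrivateElements S → (∀ {t} → t ∈ S → circ c t ⊆ U) →
                       x ∈ circ c i → x ∉ U → InI c (⁅ i ⁆ ∪ S)
  private⇒InI-insert {S = S} {x = x} {i = i} priv S⊆U x∈ci x∉U =
    ω , privateAfter⇒NBB ω (toFront-prefixes (prefixing S⁺) (prefixing-prefixes S⁺) x∈⁅x⁆∪p) privateAfter
    where
    S⁺ : Subset m
    S⁺ = ⁅ i ⁆ ∪ S
    ω : LinearOrder c
    ω = toFront i (prefixing S⁺)
    ω-i≤ : ∀ t → proj₁ ω i ≤ proj₁ ω t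
    ω-i≤ t = subst (_≤ proj₁ ω t) (sym (toFront-first i (prefixing S⁺))) z≤n
    privateAfter : ∀ {a} → a ∈ S⁺ → PrivateAfter ω S⁺ a
    privateAfter {a} a∈S⁺ with x∈p∪q⁻ ⁅ i ⁆ S a∈S⁺
    ... | inj₁ a∈⁅i⁆ rewrite x∈⁅y⁆⇒x≡y i a∈⁅i⁆ = x , x∈ci , λ t∈S⁺ ωi<ωt x∈ct →
          [ (λ t∈⁅i⁆ → <-irrefl (cong (proj₁ ω) (sym (x∈⁅y⁆⇒x≡y i t∈⁅i⁆))) ωi<ωt)
          , (λ t∈S → x∉U (S⊆U t∈S x∈ct)) ]′ (x∈p∪q⁻ ⁅ i ⁆ S t∈S⁺)
    ... | inj₂ a∈S with priv a∈S
    ...   | y , y∈ca , only = y , y∈ca , λ t∈S⁺ ωa<ωt y∈ct →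
          [ (λ t∈⁅i⁆ → <⇒≱ ωa<ωt (subst (λ t → proj₁ ω t ≤ proj₁ ω a) (sym (x∈⁅y⁆⇒x≡y i t∈⁅i⁆)) (ω-i≤ a)))
          , (λ t∈S → <-irrefl (cong (proj₁ ω) (sym (only t∈S y∈ct))) ωa<ωt) ]′ (x∈p∪q⁻ ⁅ i ⁆ S t∈S⁺)

  NBB-minimum-uncovered : ∀ ω → NBB c ω S → s ∈ S → (∀ {t} → t ∈ S → proj₁ ω s ≤ proj₁ ω t) →
                          ¬ circ c s ⊆ ⋃circ (S - s)
  NBB-minimum-uncovered {S = S} {s = s} (ω , ω-injective) nbb s∈S minimum cs⊆ with nonempty? (S - s)
  ... | yes S-s≢∅ = nbb (S - s) x∈p-y⇒x∈p (S-s≢∅ , s , s<S-s , circ⊆⋃circ⇒atomBelowJoin cs⊆)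
    where
    s<S-s : ∀ t → t ∈ S - s → ω s < ω t
    s<S-s t t∈ = ≤∧≢⇒< (minimum (x∈p-y⇒x∈p t∈)) λ ωs≡ωt → x∈p-y⇒x≢y {p = S} t∈ (sym (ω-injective ωs≡ωt))
  ... | no  S-s≡∅ with circuit-nonempty M (circ-ok c s)
  ...   | x , x∈cs = let t , t∈ , _ = ∈⋃circ⁻ (cs⊆ x∈cs) in S-s≡∅ (t , t∈)

  -- By NBB, the ω-least circuit of S is not covered by the others, so it raises their nullity.
  NBB⇒∣∣+rank⋃≤∣⋃∣ : ∀ ω → NBB c ω S → ∣ S ∣ + rank M (⋃circ S) ≤ ∣ ⋃circ S ∣
  NBB⇒∣∣+rank⋃≤∣⋃∣ {S = S} ω = go (suc ∣ S ∣) S ≤-refl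
    where
    go : ∀ k S → ∣ S ∣ < k → NBB c ω S → ∣ S ∣ + rank M (⋃circ S) ≤ ∣ ⋃circ S ∣
    go (suc k) S ∣S∣<k nbb with nonempty? S
    ... | no  S≡∅ rewrite Empty-unique S≡∅ | ∣⊥∣≡0 m = rank≤∣∣ M _
    ... | yes S≢∅ with argmin (proj₁ ω) S≢∅
    ...   | s , s∈S , minimum with p⊈q⇒∃ (NBB-minimum-uncovered ω nbb s∈S minimum)
    ...     | x , x∈cs , x∉⋃ =
              subst₂ (λ a U → a + rank M U ≤ ∣ U ∣) (sym (∣p∣≡1+∣p-x∣ s∈S)) (sym (⋃circ-remove s∈S))
                (m+n≤o⇒o+p<n+q⇒m+p<q ih (circuit-raises-nullity M (circ-ok c s) x∈cs x∉⋃))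
      where
      ih : ∣ S - s ∣ + rank M (⋃circ (S - s)) ≤ ∣ ⋃circ (S - s) ∣
      ih = go k (S - s) (≤-trans (x∈p⇒∣p-x∣<∣p∣ s∈S) (≤-pred ∣S∣<k)) λ D D⊆ → nbb D (x∈p-y⇒x∈p ∘ D⊆)

  InI⊆InS : InI c S → InS c S
  InI⊆InS {S = S} (ω , nbb) = subst (∣ S ∣ ≤_) (sym (rankOpp≡∣∁∣∸rank∁ M (⋂∁ c S)))
    (m+n≤o⇒m≤o∸n ∣ S ∣ (NBB⇒∣∣+rank⋃≤∣⋃∣ ω nbb))

  FundamentalFor : Subset n → Fin n → Fin m → Set
  FundamentalFor B x t = circ c t ⊆ ⁅ x ⁆ ∪ B × x ∈ circ c t

  fundamentalFor-exists : ∀ {B} → Indep M B → ¬ Indep M (⁅ x ⁆ ∪ B) → ∃ (FundamentalFor B x)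
  fundamentalFor-exists indB dep with fundamental-circuit M indB dep
  ... | C , C⊆xB , x∈C , circC with circ-all c C circC
  ...   | t , refl = t , C⊆xB , x∈C

  fundamentalFor-outside : ∀ {B} → FundamentalFor B x t → y ∈ circ c t → y ∉ B → y ≡ x
  fundamentalFor-outside {x = x} {B = B} (ct⊆xB , _) y∈ct y∉B =
    [ x∈⁅y⁆⇒x≡y x , (λ y∈B → contradiction y∈B y∉B) ]′ (x∈p∪q⁻ ⁅ x ⁆ B (ct⊆xB y∈ct))

  -- The fundamental circuits of the elements of U ∖ B, for B ⊆ U maximal independent;
  -- each contains its own element of U ∖ B and no other.
  fundamental-circuits : ∀ U → ∃ λ S → (∀ {t} → t ∈ S → circ c t ⊆ U) × HasPrivateElements S ×
                                       ∣ U ∣ ≤ rank M U + ∣ S ∣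
  fundamental-circuits U with rank-attained M U
  ... | B , B⊆U , indB , ∣B∣≡r
    with choose-representatives (U ∩ ∁ B) (FundamentalFor B)
           (λ x∈ → let x∈U , x∈∁B = x∈p∩q⁻ U (∁ B) x∈ in
                   fundamentalFor-exists indB (maximum⇒insert-dependent M B⊆U ∣B∣≡r x∈U (x∈∁p⇒x∉p x∈∁B)))
           (λ x∈ x′∈ Fx Fx′ → fundamentalFor-outside Fx′ (proj₂ Fx) (x∈∁p⇒x∉p (p∩q⊆q U (∁ B) x∈)))
  ... | S , ∣U∖B∣≤∣S∣ , owner , unique = S , S⊆U , priv , ∣U∣≤
    where
    S⊆U : ∀ {t} → t ∈ S → circ c t ⊆ U
    S⊆U t∈S with owner t∈S
    ... | x , x∈ , ct⊆xB , _ = ⁅x⁆∪p⊆q (p∩q⊆p U (∁ B) x∈) B⊆U ∘ ct⊆xB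
    priv : HasPrivateElements S
    priv a∈S with owner a∈S
    ... | x , x∈ , Fx = x , proj₂ Fx , λ t∈S x∈ct →
      let x′ , _ , Fx′ = owner t∈S in
      unique x∈ t∈S a∈S (subst (λ z → FundamentalFor B z _) (sym (fundamentalFor-outside Fx′ x∈ct x∉B)) Fx′)
                        Fx
      where x∉B = x∈∁p⇒x∉p (p∩q⊆q U (∁ B) x∈)
    ∣U∣≤ : ∣ U ∣ ≤ rank M U + ∣ S ∣
    ∣U∣≤ = subst (_≤ rank M U + ∣ S ∣) (sym (∣p∣≡∣p∩q∣+∣p∩∁q∣ U B))
             (+-mono-≤ (subst (_ ≤_) ∣B∣≡r (p⊆q⇒∣p∣≤∣q∣ (p∩q⊆q U B))) ∣U∖B∣≤∣S∣)

-- Adjoints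

module _ {n : ℕ} {M : Matroid n} {m : ℕ} (c : CircuitEnum M m) where

  private
    variable
      S : Subset m
      i : Fin m

  -- The atoms E ∖ C of (L*)^opp below F, i.e. the circuits C disjoint from F.
  atomsBelow : Subset n → Subset m
  atomsBelow F = tabulate (λ i → ⌊ F ⊆? ∁ (circ c i) ⌋)

  ∈atomsBelow⁻ : i ∈ atomsBelow F → F ⊆ ∁ (circ c i)
  ∈atomsBelow⁻ {F = F} = ∈-tabulate⌊⌋⁻ (λ i → F ⊆? ∁ (circ c i))

  ∈atomsBelow⁺ : F ⊆ ∁ (circ c i) → i ∈ atomsBelow F
  ∈atomsBelow⁺ {F = F} = ∈-tabulate⌊⌋⁺ (λ i → F ⊆? ∁ (circ c i))

  atomsBelow-∁circ : ∀ i → atomsBelow (∁ (circ c i)) ≡ ⁅ i ⁆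
  atomsBelow-∁circ i = ⊆-antisym
    (λ {j} j∈ → subst (_∈ ⁅ i ⁆) (sym (circ-⊆⇒≡ c (∁p⊆∁q⇒p⊇q (∈atomsBelow⁻ j∈)))) (x∈⁅x⁆ i))
    (λ {j} j∈⁅i⁆ → subst (_∈ atomsBelow _) (sym (x∈⁅y⁆⇒x≡y i j∈⁅i⁆)) (∈atomsBelow⁺ λ x∈ → x∈))

  atomsBelow-order : IsFlatDual M F → G ⊆ F ⇔ atomsBelow F ⊆ atomsBelow G
  atomsBelow-order {F = F} {G = G} flatF = mk⇔ preserve reflect
    where
    preserve : G ⊆ F → atomsBelow F ⊆ atomsBelow G
    preserve G⊆F i∈ = ∈atomsBelow⁺ (∈atomsBelow⁻ i∈ ∘ G⊆F)
    reflect : atomsBelow F ⊆ atomsBelow G → G ⊆ F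
    reflect below⊆ {x} x∈G with x ∈? F
    ... | yes x∈F = x∈F
    ... | no  x∉F =
      let t , ct⊆∁F , x∈ct = flatDual-∉⇒circ c flatF x∉F
          t∈below = ∈atomsBelow⁺ λ y∈F → x∉p⇒x∈∁p λ y∈ct → x∈∁p⇒x∉p (ct⊆∁F y∈ct) y∈F
      in contradiction x∈ct (x∈∁p⇒x∉p (∈atomsBelow⁻ (below⊆ t∈below) x∈G))

  module _ (N : Matroid m) (InI⊆indep : ∀ {S} → InI c S → Indep N S)
                           (indep⊆InS : ∀ {S} → Indep N S → InS c S) where

    rank-atomsBelow≤ : ∀ F → rank N (atomsBelow F) ≤ rankOpp M F
    rank-atomsBelow≤ F with rank-attained N (atomsBelow F)
    ... | Y , Y⊆ , indY , ∣Y∣≡r = subst (_≤ _) ∣Y∣≡r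
          (≤-trans (indep⊆InS indY) (rankOpp-antitone M F⊆⋂∁Y))
      where
      F⊆⋂∁Y : F ⊆ ⋂∁ c Y
      F⊆⋂∁Y x∈F = ∈⋂∁⁺ c λ i∈Y → x∈∁p⇒x∉p (∈atomsBelow⁻ (Y⊆ i∈Y) x∈F)

    independent-atomsBelow : ∀ F → ∃ λ S → S ⊆ atomsBelow F × Indep N S × rankOpp M F ≤ ∣ S ∣ ×
                                            (∀ {i} → i ∉ atomsBelow F → Indep N (⁅ i ⁆ ∪ S))
    independent-atomsBelow F =
      let S , S⊆∁F , priv , ∣∁F∣≤ = fundamental-circuits c (∁ F) in
      S , S⊆below S⊆∁F , InI⊆indep (private⇒InI c priv) ,
      subst (_≤ ∣ S ∣) (sym (rankOpp≡∣∁∣∸rank∁ M F)) (m≤n+o⇒m∸n≤o ∣ ∁ F ∣ _ ∣∁F∣≤) ,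
      insert-indep priv S⊆∁F
      where
      S⊆below : ∀ {S} → (∀ {t} → t ∈ S → circ c t ⊆ ∁ F) → S ⊆ atomsBelow F
      S⊆below S⊆∁F t∈S = ∈atomsBelow⁺ λ x∈F → x∉p⇒x∈∁p λ x∈ct → x∈∁p⇒x∉p (S⊆∁F t∈S x∈ct) x∈F
      insert-indep : ∀ {S i} → HasPrivateElements c S → (∀ {t} → t ∈ S → circ c t ⊆ ∁ F) →
                     i ∉ atomsBelow F → Indep N (⁅ i ⁆ ∪ S)
      insert-indep priv S⊆∁F i∉ with p⊈q⇒∃ (i∉ ∘ ∈atomsBelow⁺)
      ... | x , x∈F , x∉∁ci = InI⊆indep (private⇒InI-insert c priv S⊆∁F (x∉∁p⇒x∈p x∉∁ci) (x∈p⇒x∉∁p x∈F))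

    rank-atomsBelow : ∀ F → rank N (atomsBelow F) ≡ rankOpp M F
    rank-atomsBelow F =
      let S , S⊆ , indS , rankOpp≤∣S∣ , _ = independent-atomsBelow F in
      ≤-antisym (rank-atomsBelow≤ F) (≤-trans rankOpp≤∣S∣ (indep⇒∣∣≤rank N S⊆ indS))

    atomsBelow-flat : ∀ F → IsFlat N (atomsBelow F)
    atomsBelow-flat F i i∉ =
      let S , S⊆ , _ , rankOpp≤∣S∣ , insert-indep = independent-atomsBelow F in
      begin-strict
        rank N (atomsBelow F)           ≤⟨ ≤-trans (rank-atomsBelow≤ F) rankOpp≤∣S∣ ⟩
        ∣ S ∣                           <⟨ ∣p∣<∣⁅x⁆∪p∣ (i∉ ∘ S⊆) ⟩
        ∣ ⁅ i ⁆ ∪ S ∣                   ≤⟨ indep⇒∣∣≤rank N (⁅x⁆∪-monoʳ S⊆) (insert-indep i∉) ⟩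
        rank N (⁅ i ⁆ ∪ atomsBelow F)   ∎
      where open ≤-Reasoning

    singleton-flat : ∀ i → IsFlat N ⁅ i ⁆
    singleton-flat i = subst (IsFlat N) (atomsBelow-∁circ i) (atomsBelow-flat (∁ (circ c i)))

    rank-singleton : ∀ i → rank N ⁅ i ⁆ ≡ 1
    rank-singleton i =
      trans (indep⇒rank≡∣∣ N (InI⊆indep (private⇒InI c (singleton-private c i)))) (∣⁅x⁆∣≡1 i)

    cl-singleton : ∀ i → cl N ⁅ i ⁆ ≡ ⁅ i ⁆
    cl-singleton i = ⊆-antisym (cl⊆flat N (λ x∈ → x∈) (singleton-flat i)) (⊆cl N)

    cl-singleton-injective : Injective _≡_ _≡_ (λ i → cl N ⁅ i ⁆)
    cl-singleton-injective {i} {j} cli≡clj =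
      x∈⁅y⁆⇒x≡y j (subst (i ∈_) (trans (sym (cl-singleton i)) (trans cli≡clj (cl-singleton j)))
                         (x∈⁅x⁆ i))

    cl-singleton-atom : ∀ i → IsFlat N (cl N ⁅ i ⁆) × rank N (cl N ⁅ i ⁆) ≡ 1
    cl-singleton-atom i =
      subst (λ G → IsFlat N G × rank N G ≡ 1) (sym (cl-singleton i)) (singleton-flat i , rank-singleton i)

    rank1-flat⇒cl-singleton : ∀ G → IsFlat N G → rank N G ≡ 1 → ∃ λ i → cl N ⁅ i ⁆ ≡ G
    rank1-flat⇒cl-singleton G _ rG≡1 =
      let Y , Y⊆G , _ , ∣Y∣≡r = rank-attained N G
          i , Y≡⁅i⁆ = ∣p∣≡1⇒p≡⁅x⁆ (trans ∣Y∣≡r rG≡1)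
          ⁅i⁆⊆G = subst (_⊆ G) Y≡⁅i⁆ Y⊆G
      in i , trans (cl-singleton i)
               (⊆-antisym ⁅i⁆⊆G (flat⊆∧rank≤⇒⊇ N (singleton-flat i) ⁅i⁆⊆G
                                   (≤-reflexive (trans rG≡1 (sym (rank-singleton i))))))

    between⇒adjoint : IsAdjoint c N
    between⇒adjoint =
      cl-singleton-injective , cl-singleton-atom , rank1-flat⇒cl-singleton ,
      atomsBelow , (λ i → trans (atomsBelow-∁circ i) (sym (cl-singleton i))) ,
      (λ F _ → atomsBelow-flat F) , (λ F G flatF _ → atomsBelow-order flatF) ,
      (λ F _ → rank-atomsBelow F)

  module _ (N : Matroid m) where

    embedding : IsAdjoint c N → Subset n → Subset m
    embedding (_ , _ , _ , φ , _) = φ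

    embedding-flat : (adj : IsAdjoint c N) → IsFlatDual M X → IsFlat N (embedding adj X)
    embedding-flat (_ , _ , _ , _ , _ , φ-flat , _) = φ-flat _

    ∈embedding : (adj : IsAdjoint c N) → IsFlatDual M X → X ⊆ ∁ (circ c i) → i ∈ embedding adj X
    ∈embedding {X = X} {i = i} (_ , _ , _ , φ , φ-atom , _ , φ-order , _) flatX X⊆∁ci =
      Equivalence.to (φ-order _ X (∁circ-flatDual c i) flatX) X⊆∁ci
        (subst (i ∈_) (sym (φ-atom i)) (⊆cl N (x∈⁅x⁆ i)))

    ⊆embedding⋂∁ : (adj : IsAdjoint c N) → S ⊆ embedding adj (⋂∁ c S)
    ⊆embedding⋂∁ adj i∈S = ∈embedding adj (⋂∁-flatDual c _) λ x∈⋂ → x∉p⇒x∈∁p (∈⋂∁⁻ c x∈⋂ i∈S)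

    adjoint-indep⇒InS : IsAdjoint c N → Indep N S → InS c S
    adjoint-indep⇒InS {S = S} adj@(_ , _ , _ , _ , _ , _ , _ , φ-rank) indS =
      subst (∣ S ∣ ≤_) (φ-rank _ (⋂∁-flatDual c S)) (indep⇒∣∣≤rank N (⊆embedding⋂∁ adj) indS)

    adjoint-rank⊤ : IsAdjoint c N → rank N ⊤ ≡ rankOpp M (⋂∁ c ⊤)
    adjoint-rank⊤ adj@(_ , _ , _ , _ , _ , _ , _ , φ-rank) = trans
      (≤-antisym (rank-mono N (⊆embedding⋂∁ adj)) (rank-mono N ⊆⊤))
      (φ-rank _ (⋂∁-flatDual c ⊤))

    adjoint-singleton-indep : IsAdjoint c N → ∀ i → Indep N ⁅ i ⁆
    adjoint-singleton-indep (_ , cl-atom , _) i =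
      let Y , Y⊆⁅i⁆ , indY , ∣Y∣≡r = rank-attained N ⁅ i ⁆
          ∣⁅i⁆∣≤∣Y∣ = subst₂ _≤_ (trans (proj₂ (cl-atom i)) (sym (∣⁅x⁆∣≡1 i))) (sym ∣Y∣≡r)
                             (rank-cl≤rank N ⁅ i ⁆)
      in indep-⊆ N (p⊆q∧∣q∣≤∣p∣⇒q⊆p Y⊆⁅i⁆ ∣⁅i⁆∣≤∣Y∣) indY

    adjoint-circuit⇒atomBelowJoin : (adj : IsAdjoint c N) → ∀ {Z a} → IsCircuit N Z → a ∈ Z →
                                    AtomBelowJoin c a (Z - a)
    adjoint-circuit⇒atomBelowJoin adj@(_ , _ , _ , φ , φ-atom , _ , φ-order , _) {Z} {a} circZ a∈Z =
      Equivalence.from (φ-order _ ⋁D (∁circ-flatDual c a) (⋂∁-flatDual c D)) ca-atom⊆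
      where
      D : Subset m
      D = Z - a
      ⋁D : Subset n
      ⋁D = ⋂∁ c D
      flatφ⋁D : IsFlat N (φ ⋁D)
      flatφ⋁D = embedding-flat adj (⋂∁-flatDual c D)
      a∈φ⋁D : a ∈ φ ⋁D
      a∈φ⋁D = spanned⇒∈flat N (circuit-spanned N circZ a∈Z) (⊆embedding⋂∁ adj) flatφ⋁D
      ca-atom⊆ : φ (∁ (circ c a)) ⊆ φ ⋁D
      ca-atom⊆ = subst (_⊆ φ ⋁D) (sym (φ-atom a))
                   (cl⊆flat N (λ x∈⁅a⁆ → subst (_∈ φ ⋁D) (sym (x∈⁅y⁆⇒x≡y a x∈⁅a⁆)) a∈φ⋁D) flatφ⋁D)

    adjoint-InI⇒indep : IsAdjoint c N → InI c S → Indep N S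
    adjoint-InI⇒indep {S = S} adj (ω , nbb) with Indep? N S
    ... | yes indS = indS
    ... | no  depS with dependent⇒⊇circuit N depS
    ...   | Z , Z⊆S , circZ with argmin (proj₁ ω) (circuit-nonempty N circZ)
    ...     | a , a∈Z , minimum =
              contradiction boundedBelow (nbb (Z - a) (Z⊆S ∘ x∈p-y⇒x∈p))
      where
      Z-a≢∅ : Nonempty (Z - a)
      Z-a≢∅ with nonempty? (Z - a)
      ... | yes ne = ne
      ... | no  Z-a≡∅ = contradiction (indep-⊆ N Z⊆⁅a⁆ (adjoint-singleton-indep adj a)) (proj₁ circZ)
        where
        Z⊆⁅a⁆ : Z ⊆ ⁅ a ⁆
        Z⊆⁅a⁆ {x} x∈Z with x ≟ᶠ a
        ... | yes refl = x∈⁅x⁆ x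
        ... | no  x≢a  = contradiction (x , x∈p∧x≢y⇒x∈p-y x∈Z x≢a) Z-a≡∅
      a<Z-a : ∀ t → t ∈ Z - a → proj₁ ω a < proj₁ ω t
      a<Z-a t t∈ = ≤∧≢⇒< (minimum (x∈p-y⇒x∈p t∈)) λ ωa≡ωt → x∈p-y⇒x≢y {p = Z} t∈ (sym (proj₂ ω ωa≡ωt))
      boundedBelow : BoundedBelow c ω (Z - a)
      boundedBelow = Z-a≢∅ , a , a<Z-a , adjoint-circuit⇒atomBelowJoin adj circZ a∈Z

  adjoints-rank⊤ : ∀ N N′ → IsAdjoint c N → IsAdjoint c N′ → rank N ⊤ ≡ rank N′ ⊤
  adjoints-rank⊤ N N′ adj adj′ = trans (adjoint-rank⊤ N adj) (sym (adjoint-rank⊤ N′ adj′))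

indep⊆∧rank⊤≤⇒≤w : ∀ (N N′ : Matroid m) → (∀ {S} → Indep N S → Indep N′ S) →
                   rank N′ ⊤ ≤ rank N ⊤ → N ≤w N′
indep⊆∧rank⊤≤⇒≤w N N′ indep⊆ r′≤r B basisB@(indB , _) =
  indep⊆ indB , λ x x∉B → maximum⇒insert-dependent N′ ⊆⊤ ∣B∣≡r′ ∈⊤ x∉B
  where
  ∣B∣≡r′ : ∣ B ∣ ≡ rank N′ ⊤
  ∣B∣≡r′ = ≤-antisym (indep⇒∣∣≤rank N′ ⊆⊤ (indep⊆ indB))
                     (subst (rank N′ ⊤ ≤_) (sym (basis⇒∣∣≡rank⊤ N basisB)) r′≤r)

corollary5p2 : ∀ {n : ℕ} (M : Matroid n) {m : ℕ} (c : CircuitEnum M m) →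
    (∀ (N₁ : Matroid m) → IndepFamily c (InI c) N₁ →
       HasAdjoint c × IsMinimalAdjoint c N₁) ×
    (∀ (N₂ : Matroid m) → IndepFamily c (InS c) N₂ →
       HasAdjoint c × IsMaximumAdjoint c N₂)
corollary5p2 M c = minimal , maximum
  where
  open Equivalence

  -- N₁ is in fact below every adjoint.
  minimal : ∀ N₁ → IndepFamily c (InI c) N₁ → HasAdjoint c × IsMinimalAdjoint c N₁
  minimal N₁ indep⇔InI = (N₁ , adj₁) , adj₁ , λ N′ adj′ _ →
    indep⊆∧rank⊤≤⇒≤w N₁ N′ (adjoint-InI⇒indep c N′ adj′ ∘ indep⇒InI)
                           (≤-reflexive (adjoints-rank⊤ c N′ N₁ adj′ adj₁))
    where
    indep⇒InI : ∀ {S} → Indep N₁ S → InI c S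
    indep⇒InI {S} = to (indep⇔InI S)
    adj₁ : IsAdjoint c N₁
    adj₁ = between⇒adjoint c N₁ (λ {S} → from (indep⇔InI S)) (InI⊆InS c ∘ indep⇒InI)

  maximum : ∀ N₂ → IndepFamily c (InS c) N₂ → HasAdjoint c × IsMaximumAdjoint c N₂
  maximum N₂ indep⇔InS = (N₂ , adj₂) , adj₂ , λ N′ adj′ →
    indep⊆∧rank⊤≤⇒≤w N′ N₂ (InS⇒indep ∘ adjoint-indep⇒InS c N′ adj′)
                           (≤-reflexive (adjoints-rank⊤ c N₂ N′ adj₂ adj′))
    where
    InS⇒indep : ∀ {S} → InS c S → Indep N₂ S
    InS⇒indep {S} = from (indep⇔InS S)
    adj₂ : IsAdjoint c N₂
    adj₂ = between⇒adjoint c N₂ (InS⇒indep ∘ InI⊆InS c) (λ {S} → to (indep⇔InS S))
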